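{- Fix an integer $0\le a\le b-1$. The following statement holds: "for all integers $N\geq 1$ and all integers $n\in [0,Nb]$ with $n\equiv a \pmod b$, we have $n\in NA$ if and only if $n\notin \mathcal E(A)\cup (Nb- \mathcal E(b-A))$" if and only if $N_{a,A}=N_{a,A}^*$.
   Context: $A$ is a finite set of integers with smallest element $0$, largest element $b\ge1$, and gcd of its elements equal to $1$. $\mathbb N=\{0,1,2,\dots\}$. For an integer $N\ge1$, $NA=\{a_1+\cdots+a_N:a_i\in A\}$ (repetitions allowed), and $0A=\{0\}$. For a finite set $X$ of nonnegative integers, $\mathcal P(X)=\{\sum_{x\in X} n_x x: n_x\in\mathbb N\}$ and $\mathcal E(X)=\mathbb N\setminus\mathcal P(X)$. $b-A=\{b-x:x\in A\}$; $m-Y=\{m-y:y\in Y\}$. For an integer $c$, $n_{c,A}=\min\{n\ge 0: n\equiv c\pmod b,\ n\in\mathcal P(A)\}$ and $N_{c,A}=\min\{N\ge0: n_{c,A}\in NA\}$; $n_{c,b-A}$ is defined likewise with $b-A$ in place of $A$. $N^*_{a,A}=\frac1b(n_{a,A}+n_{b-a,b-A})$. -}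

module Defs where

open import Data.Nat using (ℕ; zero; suc; _+_; _*_; _∸_; _≤_)
open import Data.Nat.GCD using (gcd)
open import Data.List using (List; []; _∷_; map; foldr)
open import Data.Product using (Σ; ∃; _×_; _,_)
open import Data.Sum using (_⊎_)
open import Relation.Nullary using (¬_)
open import Relation.Binary.PropositionalEquality using (_≡_)
open import Data.List.Membership.Propositional using (_∈_)

-- A finite set of nonnegative integers is represented by a list (duplicates harmless).

_≡[mod_]_ : ℕ → ℕ → ℕ → Set
x ≡[mod b ] y = ∃ λ k → (x ≡ y + k * b) ⊎ (y ≡ x + k * b)

gcdList : List ℕ → ℕ
gcdList = foldr gcd 0

-- n ∈ N X : n is a sum of exactly N elements of X (repetitions allowed); 0X = {0}
data InSumset (X : List ℕ) : ℕ → ℕ → Set where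
  zero-sum : InSumset X 0 0
  step     : ∀ {N n x} → x ∈ X → InSumset X N n → InSumset X (suc N) (x + n)

data InSemigroup : List ℕ → ℕ → Set where
  nil  : InSemigroup [] 0
  cons : ∀ {x xs m} (k : ℕ) → InSemigroup xs m → InSemigroup (x ∷ xs) (k * x + m)

-- n ∈ ℰ(X) = ℕ ∖ 𝒫(X)
InExc : List ℕ → ℕ → Set
InExc X n = ¬ InSemigroup X n

reflectSet : ℕ → List ℕ → List ℕ
reflectSet b X = map (b ∸_) X

IsMin : (ℕ → Set) → ℕ → Set
IsMin P n = P n × (∀ m → P m → n ≤ m)

-- n_{c,X} relative to modulus b : min {n ≥ 0 : n ≡ c (mod b), n ∈ 𝒫(X)}
IsNmin : ℕ → List ℕ → ℕ → ℕ → Set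
IsNmin b X c = IsMin (λ n → (n ≡[mod b ] c) × InSemigroup X n)

-- N_{c,A} given n = n_{c,A} : min {N ≥ 0 : n ∈ N A}
IsBigNmin : List ℕ → ℕ → ℕ → Set
IsBigNmin X n = IsMin (λ N → InSumset X N n)

-- Write Nstar := (n_{a,A} + n_{b-a,b-A}) / b.  Always Nstar ≤ N_{a,A}: if n_{a,A} ∈ N A then
-- N b - n_{a,A} ∈ N (b-A) ⊆ 𝒫(b-A) is ≡ b-a, so it is at least n_{b-a,b-A}.  If the structure
-- statement holds, it applied to n_{a,A} at N = Nstar (whose complement N b - n_{a,A} is exactly
-- n_{b-a,b-A}) gives n_{a,A} ∈ Nstar A, so N_{a,A} = Nstar.  Conversely, if N_{a,A} = Nstar and n
-- avoids both exceptional sets, then n = n_{a,A} + k b and n + n_{b-a,b-A} ≤ N b, i.e.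
-- N_{a,A} + k ≤ N, and n is reached from n_{a,A} ∈ N_{a,A} A by adding k copies of b ∈ A and
-- N - N_{a,A} - k copies of 0 ∈ A.
module Submission where

open import Defs
open import Data.Nat using (ℕ; _+_; _*_; _∸_; _≤_; _<_)
open import Data.List using (List)
open import Data.List.Membership.Propositional using (_∈_)
open import Data.List.Relation.Unary.All using (All)
open import Data.Product using (∃; _×_; _,_)
open import Data.Sum using (_⊎_)
open import Relation.Nullary using (¬_)
open import Relation.Binary.PropositionalEquality using (_≡_)
open import Function.Bundles using (_⇔_)

open import Data.Nat using (zero; suc; NonZero; z≤n; s≤s; _≤?_)
open import Data.Nat.Properties
open import Data.Nat.DivMod
open import Data.Nat.Divisibility using (_∣_; m%n≡0⇒n∣m)
open import Data.Nat.Tactic.RingSolver using (solve-∀)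
open import Data.List using ([]; _∷_)
open import Data.List.Relation.Unary.Any using (here; there)
open import Data.List.Membership.Propositional.Properties using (∈-map⁺)
import Data.List.Relation.Unary.All as All
open import Data.Product using (proj₁; proj₂)
open import Data.Sum using (inj₁; inj₂)
open import Relation.Nullary.Decidable using (decidable-stable)
open import Relation.Binary.PropositionalEquality
  using (refl; sym; trans; cong; cong₂; subst; subst₂; module ≡-Reasoning)
open import Function.Bundles using (mk⇔; Equivalence)

InSemigroup-0 : ∀ X → InSemigroup X 0
InSemigroup-0 []       = nil
InSemigroup-0 (x ∷ xs) = cons 0 (InSemigroup-0 xs)

InSemigroup-+ : ∀ {X m n} → InSemigroup X m → InSemigroup X n → InSemigroup X (m + n)
InSemigroup-+ nil nil = nil
InSemigroup-+ (cons {x} {xs} {m} k p) (cons {m = n} l q) =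
  subst (InSemigroup (x ∷ xs)) (collect k l x m n) (cons (k + l) (InSemigroup-+ p q))
  where
  collect : ∀ k l x m n → (k + l) * x + (m + n) ≡ (k * x + m) + (l * x + n)
  collect = solve-∀

∈⇒InSemigroup : ∀ {X x} → x ∈ X → InSemigroup X x
∈⇒InSemigroup {x ∷ xs} (here refl) =
  subst (InSemigroup (x ∷ xs)) (trans (+-identityʳ (1 * x)) (*-identityˡ x)) (cons 1 (InSemigroup-0 xs))
∈⇒InSemigroup {x ∷ xs} (there p) = cons 0 (∈⇒InSemigroup p)

InSumset⇒InSemigroup : ∀ {X N n} → InSumset X N n → InSemigroup X n
InSumset⇒InSemigroup zero-sum   = InSemigroup-0 _
InSumset⇒InSemigroup (step p s) = InSemigroup-+ (∈⇒InSemigroup p) (InSumset⇒InSemigroup s)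

InSumset-≤ : ∀ {X b N n} → All (_≤ b) X → InSumset X N n → n ≤ N * b
InSumset-≤ X≤b zero-sum   = z≤n
InSumset-≤ X≤b (step p s) = +-mono-≤ (All.lookup X≤b p) (InSumset-≤ X≤b s)

[m+n]∸[o+p]≡[m∸o]+[n∸p] : ∀ {m n o p} → o ≤ m → p ≤ n → (m + n) ∸ (o + p) ≡ (m ∸ o) + (n ∸ p)
[m+n]∸[o+p]≡[m∸o]+[n∸p] {m} {n} {o} {p} o≤m p≤n = begin
  (m + n) ∸ (o + p)   ≡⟨ sym (∸-+-assoc (m + n) o p) ⟩
  (m + n) ∸ o ∸ p     ≡⟨ cong (_∸ p) (+-∸-comm n o≤m) ⟩
  (m ∸ o) + n ∸ p     ≡⟨ +-∸-assoc (m ∸ o) p≤n ⟩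
  (m ∸ o) + (n ∸ p)   ∎
  where open ≡-Reasoning

InSumset-reflect : ∀ {X b N n} → All (_≤ b) X → InSumset X N n
                 → InSumset (reflectSet b X) N (N * b ∸ n)
InSumset-reflect X≤b zero-sum = zero-sum
InSumset-reflect {X} {b} X≤b (step {N} p s) =
  subst (InSumset (reflectSet b X) (suc N))
        (sym ([m+n]∸[o+p]≡[m∸o]+[n∸p] (All.lookup X≤b p) (InSumset-≤ X≤b s)))
        (step (∈-map⁺ (b ∸_) p) (InSumset-reflect X≤b s))

InSumset-addCopies : ∀ {X x N n} → x ∈ X → InSumset X N n → ∀ k → InSumset X (k + N) (k * x + n)
InSumset-addCopies p s zero = s
InSumset-addCopies {X} {x} {N} {n} p s (suc k) =
  subst (InSumset X (suc (k + N))) (sym (+-assoc x (k * x) n)) (step p (InSumset-addCopies p s k))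

InSumset-pad : ∀ {X M N n} → 0 ∈ X → InSumset X M n → M ≤ N → InSumset X N n
InSumset-pad {X} {M} {N} {n} 0∈X s M≤N =
  subst₂ (InSumset X) (m∸n+n≡m M≤N) (cong (_+ n) (*-zeroʳ (N ∸ M)))
         (InSumset-addCopies 0∈X s (N ∸ M))

swap : ∀ u v w → u + v + w ≡ u + w + v
swap = solve-∀

module Modular (b : ℕ) .{{_ : NonZero b}} where

  ≡[mod]⇒%≡ : ∀ {x y} → x ≡[mod b ] y → x % b ≡ y % b
  ≡[mod]⇒%≡ {x} {y} (k , inj₁ e) = trans (cong (_% b) e) ([m+kn]%n≡m%n y k b)
  ≡[mod]⇒%≡ {x} {y} (k , inj₂ e) = sym (trans (cong (_% b) e) ([m+kn]%n≡m%n x k b))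

  %≡∧≤⇒≡+* : ∀ {x y} → x % b ≡ y % b → y ≤ x → ∃ λ k → x ≡ y + k * b
  %≡∧≤⇒≡+* {x} {y} e y≤x = d , (begin
      x                               ≡⟨ m≡m%n+[m/n]*n x b ⟩
      x % b + (x / b) * b             ≡⟨ cong₂ _+_ e (cong (_* b) (sym (m+[n∸m]≡n y/b≤x/b))) ⟩
      y % b + (y / b + d) * b         ≡⟨ regroup (y % b) (y / b) d b ⟩
      (y % b + (y / b) * b) + d * b   ≡⟨ cong (_+ d * b) (sym (m≡m%n+[m/n]*n y b)) ⟩
      y + d * b                       ∎)
    where
    open ≡-Reasoning
    d = x / b ∸ y / b
    y/b≤x/b : y / b ≤ x / b
    y/b≤x/b = /-mono-≤ y≤x ≤-refl
    regroup : ∀ r q d b → r + (q + d) * b ≡ (r + q * b) + d * b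
    regroup = solve-∀

  %≡⇒≡[mod] : ∀ {x y} → x % b ≡ y % b → x ≡[mod b ] y
  %≡⇒≡[mod] {x} {y} e with ≤-total y x
  ... | inj₁ y≤x = let (k , eq) = %≡∧≤⇒≡+* e y≤x in k , inj₁ eq
  ... | inj₂ x≤y = let (k , eq) = %≡∧≤⇒≡+* (sym e) x≤y in k , inj₂ eq

  ≡[mod]-cancelʳ-+ : ∀ {x y} z → (x + z) ≡[mod b ] (y + z) → x ≡[mod b ] y
  ≡[mod]-cancelʳ-+ {x} {y} z (k , inj₁ e) = k , inj₁ (+-cancelʳ-≡ z x (y + k * b) (trans e (swap y z (k * b))))
  ≡[mod]-cancelʳ-+ {x} {y} z (k , inj₂ e) = k , inj₂ (+-cancelʳ-≡ z y (x + k * b) (trans e (swap x z (k * b))))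

  %-cong-+ : ∀ {x x′ y y′} → x % b ≡ x′ % b → y % b ≡ y′ % b → (x + y) % b ≡ (x′ + y′) % b
  %-cong-+ {x} {x′} {y} {y′} ex ey =
    trans (%-distribˡ-+ x y b) (trans (cong₂ (λ u v → (u + v) % b) ex ey) (sym (%-distribˡ-+ x′ y′ b)))

  [b∸a+a]%b≡0 : ∀ {a} → a ≤ b → (b ∸ a + a) % b ≡ 0
  [b∸a+a]%b≡0 a≤b = trans (cong (_% b) (m∸n+n≡m a≤b)) (n%n≡0 b)

  complement-≡[mod] : ∀ {a n m N} → a ≤ b → n ≡[mod b ] a → n + m ≡ N * b → m ≡[mod b ] (b ∸ a)
  complement-≡[mod] {a} {n} {m} {N} a≤b n≡a n+m≡Nb = ≡[mod]-cancelʳ-+ a (%≡⇒≡[mod] (begin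
      (m + a) % b       ≡⟨ %-cong-+ {x = m} refl (sym (≡[mod]⇒%≡ n≡a)) ⟩
      (m + n) % b       ≡⟨ cong (_% b) (trans (+-comm m n) n+m≡Nb) ⟩
      (N * b) % b       ≡⟨ m*n%n≡0 N b ⟩
      0                 ≡⟨ sym ([b∸a+a]%b≡0 a≤b) ⟩
      (b ∸ a + a) % b   ∎))
    where open ≡-Reasoning

  complement-∣ : ∀ {a x y} → a ≤ b → x ≡[mod b ] a → y ≡[mod b ] (b ∸ a) → b ∣ x + y
  complement-∣ {a} {x} {y} a≤b x≡a y≡b∸a = m%n≡0⇒n∣m (x + y) b (begin
      (x + y) % b       ≡⟨ %-cong-+ (≡[mod]⇒%≡ x≡a) (≡[mod]⇒%≡ y≡b∸a) ⟩
      (a + (b ∸ a)) % b ≡⟨ cong (_% b) (+-comm a (b ∸ a)) ⟩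
      (b ∸ a + a) % b   ≡⟨ [b∸a+a]%b≡0 a≤b ⟩
      0                 ∎)
    where open ≡-Reasoning

module Characterisation
  (A : List ℕ) (b : ℕ) .{{_ : NonZero b}} (0∈A : 0 ∈ A) (b∈A : b ∈ A) (A≤b : All (_≤ b) A)
  (a : ℕ) (a≤b : a ≤ b) (nA nB NA : ℕ)
  (hA : IsNmin b A a nA) (hB : IsNmin b (reflectSet b A) (b ∸ a) nB) (hN : IsBigNmin A nA NA)
  where
  open Modular b

  B : List ℕ
  B = reflectSet b A

  HasExpectedStructure : Set
  HasExpectedStructure = ∀ (N n : ℕ) → 1 ≤ N → n ≤ N * b → n ≡[mod b ] a
    → (InSumset A N n ⇔ (¬ (InExc A n ⊎ (∃ λ m → InExc B m × (n + m ≡ N * b)))))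

  nA-minimal : ∀ {n} → n ≡[mod b ] a → InSemigroup A n → nA ≤ n
  nA-minimal n≡a n∈𝒫 = proj₂ hA _ (n≡a , n∈𝒫)

  complement∈𝒫⇒+nB≤ : ∀ {N n} → n ≤ N * b → n ≡[mod b ] a → InSemigroup B (N * b ∸ n) → n + nB ≤ N * b
  complement∈𝒫⇒+nB≤ {N} {n} n≤Nb n≡a c∈𝒫 = begin
      n + nB            ≤⟨ +-monoʳ-≤ n (proj₂ hB _ (complement-≡[mod] {N = N} a≤b n≡a n+c≡Nb , c∈𝒫)) ⟩
      n + (N * b ∸ n)   ≡⟨ n+c≡Nb ⟩
      N * b             ∎
    where
    open ≤-Reasoning
    n+c≡Nb : n + (N * b ∸ n) ≡ N * b
    n+c≡Nb = m+[n∸m]≡n n≤Nb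

  b∣nA+nB : b ∣ nA + nB
  b∣nA+nB = complement-∣ a≤b (proj₁ (proj₁ hA)) (proj₁ (proj₁ hB))

  Nstar : ℕ
  Nstar = _∣_.quotient b∣nA+nB

  nA+nB≡Nstar*b : nA + nB ≡ Nstar * b
  nA+nB≡Nstar*b = _∣_.equality b∣nA+nB

  Nstar≤NA : Nstar ≤ NA
  Nstar≤NA = *-cancelʳ-≤ Nstar NA b (subst (_≤ NA * b) nA+nB≡Nstar*b
    (complement∈𝒫⇒+nB≤ {NA} (InSumset-≤ A≤b nA∈NA·A) (proj₁ (proj₁ hA))
          (InSumset⇒InSemigroup (InSumset-reflect A≤b nA∈NA·A))))
    where
    nA∈NA·A : InSumset A NA nA
    nA∈NA·A = proj₁ hN

  structure⇒nA∈Nstar·A : HasExpectedStructure → InSumset A Nstar nA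
  structure⇒nA∈Nstar·A H with Nstar in eq
  ... | zero = subst (InSumset A 0) (sym (m+n≡0⇒m≡0 nA (trans nA+nB≡Nstar*b (cong (_* b) eq)))) zero-sum
  ... | N@(suc _) = Equivalence.from (H N nA (s≤s z≤n) nA≤Nb (proj₁ (proj₁ hA))) avoids
    where
    nA+nB≡Nb : nA + nB ≡ N * b
    nA+nB≡Nb = trans nA+nB≡Nstar*b (cong (_* b) eq)
    nA≤Nb : nA ≤ N * b
    nA≤Nb = subst (nA ≤_) nA+nB≡Nb (m≤m+n nA nB)
    avoids : ¬ (InExc A nA ⊎ (∃ λ m → InExc B m × (nA + m ≡ N * b)))
    avoids (inj₁ nA∉𝒫) = nA∉𝒫 (proj₂ (proj₁ hA))
    avoids (inj₂ (m , m∉𝒫 , nA+m≡Nb)) =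
      m∉𝒫 (subst (InSemigroup B) (+-cancelˡ-≡ nA nB m (trans nA+nB≡Nb (sym nA+m≡Nb))) (proj₂ (proj₁ hB)))

  structure⇒NA≡Nstar : HasExpectedStructure → NA ≡ Nstar
  structure⇒NA≡Nstar H = ≤-antisym (proj₂ hN Nstar (structure⇒nA∈Nstar·A H)) Nstar≤NA

  NA≡Nstar⇒structure : NA * b ≡ nA + nB → HasExpectedStructure
  NA≡Nstar⇒structure NA*b≡ N n 1≤N n≤Nb n≡a = mk⇔ avoids reached
    where
    avoids : InSumset A N n → ¬ (InExc A n ⊎ (∃ λ m → InExc B m × (n + m ≡ N * b)))
    avoids s (inj₁ n∉𝒫) = n∉𝒫 (InSumset⇒InSemigroup s)
    avoids s (inj₂ (m , m∉𝒫 , n+m≡Nb)) =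
      m∉𝒫 (subst (InSemigroup B) (trans (cong (_∸ n) (sym n+m≡Nb)) (m+n∸m≡n n m))
                 (InSumset⇒InSemigroup (InSumset-reflect A≤b s)))

    reached : ¬ (InExc A n ⊎ (∃ λ m → InExc B m × (n + m ≡ N * b))) → InSumset A N n
    reached R = InSumset-pad 0∈A (subst (InSumset A (k + NA)) n≡ (InSumset-addCopies b∈A (proj₁ hN) k)) k+NA≤N
      where
      nA≤n : nA ≤ n
      nA≤n = decidable-stable (nA ≤? n) λ nA≰n → R (inj₁ λ n∈𝒫 → nA≰n (nA-minimal n≡a n∈𝒫))
      n+nB≤Nb : n + nB ≤ N * b
      n+nB≤Nb = decidable-stable (n + nB ≤? N * b) λ n+nB≰Nb →
        R (inj₂ (N * b ∸ n , (λ c∈𝒫 → n+nB≰Nb (complement∈𝒫⇒+nB≤ {N} n≤Nb n≡a c∈𝒫)) , m+[n∸m]≡n n≤Nb))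
      n≡nA+kb : ∃ λ k → n ≡ nA + k * b
      n≡nA+kb = %≡∧≤⇒≡+* (trans (≡[mod]⇒%≡ n≡a) (sym (≡[mod]⇒%≡ (proj₁ (proj₁ hA))))) nA≤n
      k : ℕ
      k = proj₁ n≡nA+kb
      n≡ : k * b + nA ≡ n
      n≡ = trans (+-comm (k * b) nA) (sym (proj₂ n≡nA+kb))
      k+NA≤N : k + NA ≤ N
      k+NA≤N = *-cancelʳ-≤ (k + NA) N b (begin
        (k + NA) * b      ≡⟨ *-distribʳ-+ b k NA ⟩
        k * b + NA * b    ≡⟨ cong (k * b +_) NA*b≡ ⟩
        k * b + (nA + nB) ≡⟨ sym (+-assoc (k * b) nA nB) ⟩
        k * b + nA + nB   ≡⟨ cong (_+ nB) n≡ ⟩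
        n + nB            ≤⟨ n+nB≤Nb ⟩
        N * b             ∎)
        where open ≤-Reasoning

mainTheorem7 : (A : List ℕ) (b : ℕ) → 1 ≤ b → 0 ∈ A → b ∈ A → All (λ x → x ≤ b) A
    → gcdList A ≡ 1
    → (a : ℕ) → a < b
    → (nA nB NA : ℕ)
    → IsNmin b A a nA
    → IsNmin b (reflectSet b A) (b ∸ a) nB
    → IsBigNmin A nA NA
    → ((∀ (N n : ℕ) → 1 ≤ N → n ≤ N * b → n ≡[mod b ] a
          → (InSumset A N n ⇔ (¬ (InExc A n ⊎ (∃ λ m → InExc (reflectSet b A) m × (n + m ≡ N * b))))))
       ⇔ (b * NA ≡ nA + nB))
mainTheorem7 A b@(suc _) _ 0∈A b∈A A≤b _ a a<b nA nB NA hA hB hN =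
  mk⇔ (λ H → begin
         b * NA       ≡⟨ cong (b *_) (structure⇒NA≡Nstar H) ⟩
         b * Nstar    ≡⟨ *-comm b Nstar ⟩
         Nstar * b    ≡⟨ sym nA+nB≡Nstar*b ⟩
         nA + nB      ∎)
      (λ E → NA≡Nstar⇒structure (trans (*-comm NA b) E))
  where
  open Characterisation A b 0∈A b∈A A≤b a (<⇒≤ a<b) nA nB NA hA hB hN
  open ≡-Reasoning
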